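{- Let $\mathfrak{H}$ be the category of set-system hypergraphs. For $G\in\mathfrak{H}$ define $\tilde{G}$ by $V(\tilde G):=(\{1\}\times V(G))\cup\{(0,0)\}$, $E(\tilde G):=(\{1\}\times E(G))\cup(\{0\}\times\mathcal{P}V(\tilde G))$, $\epsilon_{\tilde G}(1,x):=\{1\}\times\epsilon_G(x)$ and $\epsilon_{\tilde G}(0,x):=x$, and define $\eta_G:G\to\tilde G$ by $V(\eta_G)(v)=(1,v)$, $E(\eta_G)(e)=(1,e)$. If $\phi:H\to K$ and $\psi:H\to G$ are morphisms in $\mathfrak{H}$ with $\phi$ a monomorphism, then there is a unique morphism $\hat\psi:K\to\tilde G$ in $\mathfrak{H}$ such that the square $K\xleftarrow{\phi}H\xrightarrow{\psi}G$ is a pullback of $K\xrightarrow{\hat\psi}\tilde G\xleftarrow{\eta_G}G$. Consequently, if $T$ is a terminal object of $\mathfrak{H}$, then $\tilde T$ equipped with $\eta_T$ is a subobject classifier for $\mathfrak{H}$.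
   Context: A set-system hypergraph $G$ consists of sets $V(G)$, $E(G)$ and a function $\epsilon_G:E(G)\to\mathcal{P}(V(G))$ (edges may be empty). A morphism $\phi:G\to H$ is a pair of functions $V(\phi):V(G)\to V(H)$, $E(\phi):E(G)\to E(H)$ with $\epsilon_H\circ E(\phi)=\mathcal{P}V(\phi)\circ\epsilon_G$, where $\mathcal{P}f(A)=\{f(a):a\in A\}$. This forms the category $\mathfrak{H}$ (the comma category $(\mathrm{id}_{\mathbf{Set}}\downarrow\mathcal{P})$). -}

module Defs where

open import Level using (Level; suc)
open import Data.Bool using (Bool; true; false)
open import Data.Sum using (_⊎_; inj₁; inj₂)
open import Data.Product using (Σ; ∃; _×_; _,_; proj₁)
open import Data.Unit.Polymorphic using (⊤; tt)
open import Relation.Nullary using (does; yes; no; ¬_)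
open import Data.Empty using (⊥; ⊥-elim)
open import Relation.Binary.PropositionalEquality using (_≡_; refl; sym; trans)
open import Axiom.ExcludedMiddle using (ExcludedMiddle)

-- Set-system hypergraphs, with the (classical) power set 𝒫 V rendered as
-- characteristic functions V → Bool.  Classical reasoning is available
-- through the module parameter lem (excluded middle), which is needed to
-- define the direct image 𝒫 f.
module Hyp {ℓ : Level} (lem : ExcludedMiddle ℓ) where

  𝒫 : Set ℓ → Set ℓ
  𝒫 V = V → Bool

  image : {A B : Set ℓ} → (A → B) → 𝒫 A → 𝒫 B
  image {A} f X b = does (lem {∃ λ (a : A) → X a ≡ true × f a ≡ b})

  record Hypergraph : Set (suc ℓ) where
    field
      V : Set ℓ
      E : Set ℓ
      ε : E → 𝒫 V
  open Hypergraph public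

  record Hom (G H : Hypergraph) : Set ℓ where
    field
      vmap : V G → V H
      emap : E G → E H
      comm : ∀ e w → ε H (emap e) w ≡ image vmap (ε G e) w
  open Hom public

  _≈_ : {G H : Hypergraph} → Hom G H → Hom G H → Set ℓ
  f ≈ g = (∀ v → vmap f v ≡ vmap g v) × (∀ e → emap f e ≡ emap g e)

  Commutes : {A B C D : Hypergraph} →
             Hom B D → Hom A B → Hom C D → Hom A C → Set ℓ
  Commutes f g h k =
    (∀ v → vmap f (vmap g v) ≡ vmap h (vmap k v)) ×
    (∀ e → emap f (emap g e) ≡ emap h (emap k e))

  Tri : {A B C : Hypergraph} → Hom B C → Hom A B → Hom A C → Set ℓ
  Tri f g h =
    (∀ v → vmap f (vmap g v) ≡ vmap h v) ×
    (∀ e → emap f (emap g e) ≡ emap h e)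

  IsMono : {H K : Hypergraph} → Hom H K → Set (suc ℓ)
  IsMono {H} {K} φ = (Q : Hypergraph) (a b : Hom Q H) →
    Commutes φ a φ b → a ≈ b

  IsTerminal : Hypergraph → Set (suc ℓ)
  IsTerminal T = (Q : Hypergraph) → Σ (Hom Q T) λ u → (v : Hom Q T) → v ≈ u

  IsPullback : {H K G X : Hypergraph} →
               Hom H K → Hom H G → Hom K X → Hom G X → Set (suc ℓ)
  IsPullback {H} {K} {G} f g h k =
    Commutes h f k g ×
    ((Q : Hypergraph) (α : Hom Q K) (β : Hom Q G) → Commutes h α k β →
       Σ (Hom Q H) λ u → (Tri f u α × Tri g u β) ×
         ((u' : Hom Q H) → Tri f u' α × Tri g u' β → u' ≈ u))

  IsSubobjectClassifier : (T : Hypergraph) → IsTerminal T →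
                          (Ω : Hypergraph) → Hom T Ω → Set (suc ℓ)
  IsSubobjectClassifier T term Ω tr =
    (H K : Hypergraph) (φ : Hom H K) → IsMono φ →
      Σ (Hom K Ω) λ χ → IsPullback φ (proj₁ (term H)) χ tr ×
        ((χ' : Hom K Ω) → IsPullback φ (proj₁ (term H)) χ' tr → χ' ≈ χ)

  -- the construction G̃ : inj₁ tt plays (0,0), inj₂ v plays (1,v);
  -- edges inj₁ e play (1,e), edges inj₂ x (x ⊆ V(G̃)) play (0,x)
  Ṽ : Hypergraph → Set ℓ
  Ṽ G = ⊤ {ℓ} ⊎ V G

  εt : (G : Hypergraph) → E G ⊎ 𝒫 (Ṽ G) → 𝒫 (Ṽ G)
  εt G (inj₁ e) (inj₁ _) = false
  εt G (inj₁ e) (inj₂ v) = ε G e v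
  εt G (inj₂ x) w = x w

  tilde : Hypergraph → Hypergraph
  tilde G = record { V = Ṽ G ; E = E G ⊎ 𝒫 (Ṽ G) ; ε = εt G }

  private
    does-no : {P : Set ℓ} → ¬ P → does (lem {P}) ≡ false
    does-no {P} ¬p with lem {P}
    ... | yes p = ⊥-elim (¬p p)
    ... | no _ = refl

    does-yes : {P : Set ℓ} → P → does (lem {P}) ≡ true
    does-yes {P} p with lem {P}
    ... | yes _ = refl
    ... | no ¬p = ⊥-elim (¬p p)

    η-comm : (G : Hypergraph) (e : E G) (w : Ṽ G) →
             εt G (inj₁ e) w ≡ image inj₂ (ε G e) w
    η-comm G e (inj₁ t) = sym (does-no λ { (a , _ , ()) })
    η-comm G e (inj₂ v) with ε G e v in p
    ... | true = sym (does-yes (v , p , refl))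
    ... | false = sym (does-no λ { (a , q , refl) → f (trans (sym p) q) })
      where
        f : false ≡ true → ⊥
        f ()

  η : (G : Hypergraph) → Hom G (tilde G)
  η G = record { vmap = inj₂ ; emap = inj₁ ; comm = η-comm G }

module Submission where

-- For a mono φ : H → K and ψ : H → G the
-- classifying map ψ̂ : K → G̃ sends a vertex or edge in the image of φ to
-- η ∘ ψ of its (unique) φ-preimage; any other vertex goes to the extra
-- vertex (0,0), and any other edge e to the new edge (0, ψ̂[ε_K e]).
--
-- The
-- subobject classifier property is the case G = T terminal.

open import Level using (Level)
import Level
open import Data.Bool using (Bool; true; false)
open import Data.Empty using (⊥-elim)
import Data.Empty.Polymorphic as Polymorphic
open import Data.Product using (Σ; ∃; _×_; _,_; proj₁; proj₂)
open import Data.Sum using (inj₁; inj₂)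
open import Data.Sum.Properties using (inj₁-injective; inj₂-injective)
open import Data.Unit.Polymorphic using (⊤; tt)
open import Function using (_∘_)
open import Function.Definitions using (Injective)
open import Relation.Nullary using (Dec; does; yes; no)
open import Relation.Binary.PropositionalEquality
  using (_≡_; refl; sym; trans; cong; subst; module ≡-Reasoning)
open import Axiom.ExcludedMiddle using (ExcludedMiddle)
open import Axiom.Extensionality.Propositional
  using (Extensionality; lower-extensionality)
open import Defs

module Toolkit {ℓ : Level} (lem : ExcludedMiddle ℓ) where
  open Hyp lem

  private
    does-true : {P : Set ℓ} (d : Dec P) → does d ≡ true → P
    does-true (yes p) _ = p
    does-true (no _) ()

    true-does : {P : Set ℓ} (d : Dec P) → P → does d ≡ true
    true-does (yes _) _ = refl
    true-does (no ¬p) p = ⊥-elim (¬p p)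

  image-elim : {A B : Set ℓ} {f : A → B} {X : 𝒫 A} {b : B} →
    image f X b ≡ true → ∃ λ a → X a ≡ true × f a ≡ b
  image-elim = does-true lem

  image-intro : {A B : Set ℓ} {f : A → B} {X : 𝒫 A} {b : B} (a : A) →
    X a ≡ true → f a ≡ b → image f X b ≡ true
  image-intro a xa fa = true-does lem (a , xa , fa)

  same-members : {b c : Bool} → (b ≡ true → c ≡ true) → (c ≡ true → b ≡ true) → b ≡ c
  same-members {false} {false} _ _ = refl
  same-members {false} {true}  _ c⇒b = c⇒b refl
  same-members {true}  {false} b⇒c _ = sym (b⇒c refl)
  same-members {true}  {true}  _ _ = refl

  image-injective : {A B : Set ℓ} {f : A → B} → Injective _≡_ _≡_ f →
    (X : 𝒫 A) (a : A) → image f X (f a) ≡ X a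
  image-injective {f = f} f-inj X a =
    same-members (λ t → from-preimage (image-elim t)) (λ xa → image-intro a xa refl)
    where
      from-preimage : (∃ λ a' → X a' ≡ true × f a' ≡ f a) → X a ≡ true
      from-preimage (a' , xa' , fa'≡fa) = subst (λ z → X z ≡ true) (f-inj fa'≡fa) xa'

  image-cong : {A B : Set ℓ} {f g : A → B} {X Y : 𝒫 A} →
    (∀ a → f a ≡ g a) → (∀ a → X a ≡ Y a) → ∀ b → image f X b ≡ image g Y b
  image-cong {f = f} {g} {X} {Y} f≗g X≗Y b =
    same-members (λ t → forth (image-elim t)) (λ t → back (image-elim t))
    where
      forth : (∃ λ a → X a ≡ true × f a ≡ b) → image g Y b ≡ true
      forth (a , xa , fa) = image-intro a (trans (sym (X≗Y a)) xa) (trans (sym (f≗g a)) fa)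
      back : (∃ λ a → Y a ≡ true × g a ≡ b) → image f X b ≡ true
      back (a , ya , ga) = image-intro a (trans (X≗Y a) ya) (trans (f≗g a) ga)

  image-∘ : {A B C : Set ℓ} (f : B → C) (g : A → B) (Y : 𝒫 A) (c : C) →
    image (f ∘ g) Y c ≡ image f (image g Y) c
  image-∘ f g Y c = same-members (λ t → forth (image-elim t)) (λ t → back (image-elim t))
    where
      forth : (∃ λ a → Y a ≡ true × f (g a) ≡ c) → image f (image g Y) c ≡ true
      forth (a , ya , fga) = image-intro (g a) (image-intro a ya refl) fga
      back : (∃ λ b → image g Y b ≡ true × f b ≡ c) → image (f ∘ g) Y c ≡ true
      back (b , gYb , fb) with image-elim {f = g} {X = Y} gYb
      ... | a , ya , refl = image-intro a ya fb

  _∘ʰ_ : {F G H : Hypergraph} → Hom G H → Hom F G → Hom F H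
  _∘ʰ_ {F} {G} {H} f g = record
    { vmap = vmap f ∘ vmap g
    ; emap = emap f ∘ emap g
    ; comm = λ e w → begin
        ε H (emap f (emap g e)) w              ≡⟨ comm f (emap g e) w ⟩
        image (vmap f) (ε G (emap g e)) w      ≡⟨ image-cong (λ _ → refl) (comm g e) w ⟩
        image (vmap f) (image (vmap g) (ε F e)) w ≡⟨ sym (image-∘ (vmap f) (vmap g) (ε F e) w) ⟩
        image (vmap f ∘ vmap g) (ε F e) w      ∎
    }
    where open ≡-Reasoning

  incidence-reflected : {H K : Hypergraph} (φ : Hom H K) → Injective _≡_ _≡_ (vmap φ) →
    ∀ e w → ε H e w ≡ ε K (emap φ e) (vmap φ w)
  incidence-reflected {H} φ φ-inj e w =
    sym (trans (comm φ e (vmap φ w)) (image-injective φ-inj (ε H e) w))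

  lift : {Q H K : Hypergraph} (φ : Hom H K) → Injective _≡_ _≡_ (vmap φ) →
    (α : Hom Q K) (uV : V Q → V H) (uE : E Q → E H) →
    (∀ q → vmap φ (uV q) ≡ vmap α q) → (∀ e → emap φ (uE e) ≡ emap α e) → Hom Q H
  lift {Q} {H} {K} φ φ-inj α uV uE uVφ uEφ = record
    { vmap = uV
    ; emap = uE
    ; comm = λ e w → begin
        ε H (uE e) w                             ≡⟨ incidence-reflected φ φ-inj (uE e) w ⟩
        ε K (emap φ (uE e)) (vmap φ w)           ≡⟨ cong (λ x → ε K x (vmap φ w)) (uEφ e) ⟩
        ε K (emap α e) (vmap φ w)                ≡⟨ comm α e (vmap φ w) ⟩
        image (vmap α) (ε Q e) (vmap φ w)        ≡⟨ image-cong (sym ∘ uVφ) (λ _ → refl) (vmap φ w) ⟩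
        image (vmap φ ∘ uV) (ε Q e) (vmap φ w)   ≡⟨ image-∘ (vmap φ) uV (ε Q e) (vmap φ w) ⟩
        image (vmap φ) (image uV (ε Q e)) (vmap φ w) ≡⟨ image-injective φ-inj (image uV (ε Q e)) w ⟩
        image uV (ε Q e) w                       ∎
    }
    where open ≡-Reasoning

  Point : Hypergraph
  Point = record { V = ⊤ ; E = Polymorphic.⊥ ; ε = λ () }

  point : {K : Hypergraph} → V K → Hom Point K
  point k = record { vmap = λ _ → k ; emap = λ () ; comm = λ () }

  SingleEdge : Set ℓ → Hypergraph
  SingleEdge S = record { V = S ; E = ⊤ ; ε = λ _ _ → true }

  single-edge : {S : Set ℓ} {X : Hypergraph} (f : S → V X) (x : E X) →
    (∀ w → ε X x w ≡ image f (λ _ → true) w) → Hom (SingleEdge S) X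
  single-edge f x x-image = record { vmap = f ; emap = λ _ → x ; comm = λ _ → x-image }

  Support : (X : Hypergraph) → E X → Set ℓ
  Support X x = Σ (V X) λ v → ε X x v ≡ true

  support-image : (X : Hypergraph) (x : E X) →
    ∀ w → ε X x w ≡ image {A = Support X x} proj₁ (λ _ → true) w
  support-image X x w =
    same-members (λ xw → image-intro (w , xw) refl refl) (λ t → in-support (image-elim t))
    where
      in-support : (∃ λ (s : Support X x) → true ≡ true × proj₁ s ≡ w) → ε X x w ≡ true
      in-support ((v , xv) , _ , refl) = xv

  spanned-by : (X : Hypergraph) (x : E X) → Hom (SingleEdge (Support X x)) X
  spanned-by X x = single-edge proj₁ x (support-image X x)

  -- Monomorphisms are injective on vertices (probe with points) …
  mono-injectiveⱽ : {H K : Hypergraph} (φ : Hom H K) → IsMono φ → Injective _≡_ _≡_ (vmap φ)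
  mono-injectiveⱽ φ mono {a} {b} φa≡φb =
    proj₁ (mono Point (point a) (point b) ((λ _ → φa≡φb) , λ ())) tt

  -- … and on edges: two edges with the same φ-image have the same vertex set
  -- (incidence is reflected), so both are single-edge maps out of that support.
  mono-injectiveᴱ : {H K : Hypergraph} (φ : Hom H K) → IsMono φ → Injective _≡_ _≡_ (emap φ)
  mono-injectiveᴱ {H} {K} φ mono {e₁} {e₂} φe₁≡φe₂ =
    proj₂ (mono (SingleEdge (Support H e₁)) edge₁ edge₂ ((λ _ → refl) , λ _ → φe₁≡φe₂)) tt
    where
      φ-inj : Injective _≡_ _≡_ (vmap φ)
      φ-inj = mono-injectiveⱽ φ mono
      same-vertices : ∀ w → ε H e₂ w ≡ ε H e₁ w
      same-vertices w = begin
        ε H e₂ w                     ≡⟨ incidence-reflected φ φ-inj e₂ w ⟩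
        ε K (emap φ e₂) (vmap φ w)   ≡⟨ cong (λ x → ε K x (vmap φ w)) (sym φe₁≡φe₂) ⟩
        ε K (emap φ e₁) (vmap φ w)   ≡⟨ sym (incidence-reflected φ φ-inj e₁ w) ⟩
        ε H e₁ w                     ∎
        where open ≡-Reasoning
      edge₁ edge₂ : Hom (SingleEdge (Support H e₁)) H
      edge₁ = spanned-by H e₁
      edge₂ = single-edge proj₁ e₂ (λ w → trans (same-vertices w) (support-image H e₁ w))

  module Classifier (ext : Extensionality ℓ ℓ)
    (H K G : Hypergraph) (φ : Hom H K) (ψ : Hom H G) (mono : IsMono φ) where

    φ-injⱽ : Injective _≡_ _≡_ (vmap φ)
    φ-injⱽ = mono-injectiveⱽ φ mono

    φ-injᴱ : Injective _≡_ _≡_ (emap φ)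
    φ-injᴱ = mono-injectiveᴱ φ mono

    InImageⱽ : V K → Set ℓ
    InImageⱽ k = ∃ λ h → vmap φ h ≡ k

    InImageᴱ : E K → Set ℓ
    InImageᴱ e = ∃ λ e' → emap φ e' ≡ e

    classifyⱽ′ : (k : V K) → Dec (InImageⱽ k) → Ṽ G
    classifyⱽ′ k (yes (h , _)) = inj₂ (vmap ψ h)
    classifyⱽ′ k (no _)        = inj₁ tt

    classifyⱽ : V K → Ṽ G
    classifyⱽ k = classifyⱽ′ k lem

    classifyᴱ′ : (e : E K) → Dec (InImageᴱ e) → E (tilde G)
    classifyᴱ′ e (yes (e' , _)) = inj₁ (emap ψ e')
    classifyᴱ′ e (no _)         = inj₂ (image classifyⱽ (ε K e))

    classifyᴱ : E K → E (tilde G)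
    classifyᴱ e = classifyᴱ′ e lem

    classifyⱽ-φ : ∀ h → classifyⱽ (vmap φ h) ≡ inj₂ (vmap ψ h)
    classifyⱽ-φ h = on-image lem
      where
        on-image : (d : Dec (InImageⱽ (vmap φ h))) → classifyⱽ′ _ d ≡ inj₂ (vmap ψ h)
        on-image (yes (h' , φh'≡φh)) = cong (inj₂ ∘ vmap ψ) (φ-injⱽ φh'≡φh)
        on-image (no ∉image)         = ⊥-elim (∉image (h , refl))

    classifyᴱ-φ : ∀ e → classifyᴱ (emap φ e) ≡ inj₁ (emap ψ e)
    classifyᴱ-φ e = on-image lem
      where
        on-image : (d : Dec (InImageᴱ (emap φ e))) → classifyᴱ′ _ d ≡ inj₁ (emap ψ e)
        on-image (yes (e' , φe'≡φe)) = cong (inj₁ ∘ emap ψ) (φ-injᴱ φe'≡φe)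
        on-image (no ∉image)         = ⊥-elim (∉image (e , refl))

    classifyⱽ-old : ∀ k {g} → classifyⱽ k ≡ inj₂ g → InImageⱽ k
    classifyⱽ-old k = old lem
      where
        old : ∀ {g} (d : Dec (InImageⱽ k)) → classifyⱽ′ k d ≡ inj₂ g → InImageⱽ k
        old (yes p) _ = p
        old (no _) ()

    classifyᴱ-old : ∀ e {g} → classifyᴱ e ≡ inj₁ g → InImageᴱ e
    classifyᴱ-old e = old lem
      where
        old : ∀ {g} (d : Dec (InImageᴱ e)) → classifyᴱ′ e d ≡ inj₁ g → InImageᴱ e
        old (yes p) _ = p
        old (no _) ()

    -- ψ̂ is a morphism.  New edges carry the image of their vertex set by
    -- definition; on an old edge φ e' the condition follows by transporting
    -- the morphism condition of η ∘ ψ along φ.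
    classify-comm : ∀ e w (d : Dec (InImageᴱ e)) →
      εt G (classifyᴱ′ e d) w ≡ image classifyⱽ (ε K e) w
    classify-comm e w (no _) = refl
    classify-comm _ w (yes (e' , refl)) = begin
      εt G (inj₁ (emap ψ e')) w                          ≡⟨ comm (η G ∘ʰ ψ) e' w ⟩
      image (inj₂ ∘ vmap ψ) (ε H e') w                  ≡⟨ image-cong (sym ∘ classifyⱽ-φ) (λ _ → refl) w ⟩
      image (classifyⱽ ∘ vmap φ) (ε H e') w              ≡⟨ image-∘ classifyⱽ (vmap φ) (ε H e') w ⟩
      image classifyⱽ (image (vmap φ) (ε H e')) w        ≡⟨ image-cong (λ _ → refl) (sym ∘ comm φ e') w ⟩
      image classifyⱽ (ε K (emap φ e')) w                ∎
      where open ≡-Reasoning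

    ψ̂ : Hom K (tilde G)
    ψ̂ = record { vmap = classifyⱽ ; emap = classifyᴱ ; comm = λ e w → classify-comm e w lem }

    -- A cone over the cospan lands in the image of φ; the factorisation is
    -- the lift of α along φ, unique because φ is injective.
    universal : (Q : Hypergraph) (α : Hom Q K) (β : Hom Q G) → Commutes ψ̂ α (η G) β →
      Σ (Hom Q H) λ u → (Tri φ u α × Tri ψ u β) ×
        ((u' : Hom Q H) → Tri φ u' α × Tri ψ u' β → u' ≈ u)
    universal Q α β (α-oldⱽ , α-oldᴱ) =
      u , ((uVφ , uEφ) , (uVψ , uEψ)) , unique-factor
      where
        uV : V Q → V H
        uV q = proj₁ (classifyⱽ-old _ (α-oldⱽ q))
        uVφ : ∀ q → vmap φ (uV q) ≡ vmap α q
        uVφ q = proj₂ (classifyⱽ-old _ (α-oldⱽ q))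
        uE : E Q → E H
        uE e = proj₁ (classifyᴱ-old _ (α-oldᴱ e))
        uEφ : ∀ e → emap φ (uE e) ≡ emap α e
        uEφ e = proj₂ (classifyᴱ-old _ (α-oldᴱ e))
        uVψ : ∀ q → vmap ψ (uV q) ≡ vmap β q
        uVψ q = inj₂-injective
          (trans (sym (classifyⱽ-φ (uV q))) (trans (cong classifyⱽ (uVφ q)) (α-oldⱽ q)))
        uEψ : ∀ e → emap ψ (uE e) ≡ emap β e
        uEψ e = inj₁-injective
          (trans (sym (classifyᴱ-φ (uE e))) (trans (cong classifyᴱ (uEφ e)) (α-oldᴱ e)))
        u : Hom Q H
        u = lift φ φ-injⱽ α uV uE uVφ uEφ
        unique-factor : (u' : Hom Q H) → Tri φ u' α × Tri ψ u' β → u' ≈ u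
        unique-factor u' ((u'Vφ , u'Eφ) , _) =
          (λ q → φ-injⱽ (trans (u'Vφ q) (sym (uVφ q)))) ,
          (λ e → φ-injᴱ (trans (u'Eφ e) (sym (uEφ e))))

    pullback : IsPullback φ ψ ψ̂ (η G)
    pullback = (classifyⱽ-φ , classifyᴱ-φ) , universal

    module _ (χ : Hom K (tilde G)) (χ-pullback : IsPullback φ ψ χ (η G)) where

      -- A vertex sent into η[G] lies in the image of φ (probe with a point).
      χ-oldⱽ : ∀ k {g} → vmap χ k ≡ inj₂ g → InImageⱽ k
      χ-oldⱽ k {g} χk≡g with proj₂ χ-pullback Point (point k) (point g) ((λ _ → χk≡g) , λ ())
      ... | u , ((uVφ , _) , _) , _ = vmap u tt , uVφ tt

      old-edge-member : ∀ {x y} → εt G (inj₁ x) y ≡ true → ∃ λ w → y ≡ inj₂ w × ε G x w ≡ true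
      old-edge-member {y = inj₂ w} xw = w , refl , xw

      -- If χ sends e to an old edge η(x), then χ restricted to the edge
      -- spanned by e factors through η: its vertices land in η[x] ⊆ η[G].
      old-edge-cone : ∀ e {x} → emap χ e ≡ inj₁ x →
        Σ (Hom (SingleEdge (Support K e)) G) λ β → Commutes χ (spanned-by K e) (η G) β
      old-edge-cone e {x} χe≡x =
        single-edge βV x x-image , (λ s → proj₁ (proj₂ (old s))) , λ _ → χe≡x
        where
          χ-on-support : ((v , ev) : Support K e) → εt G (inj₁ x) (vmap χ v) ≡ true
          χ-on-support (v , ev) = trans (cong (λ y → εt G y (vmap χ v)) (sym χe≡x))
                                        (trans (comm χ e (vmap χ v)) (image-intro v ev refl))
          old : (s : Support K e) → ∃ λ w → vmap χ (proj₁ s) ≡ inj₂ w × ε G x w ≡ true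
          old s = old-edge-member (χ-on-support s)
          βV : Support K e → V G
          βV s = proj₁ (old s)
          x-image : ∀ w → ε G x w ≡ image βV (λ _ → true) w
          x-image w = same-members (λ xw → hit (image-elim (in-χe xw)))
                                   (λ t → reached (image-elim t))
            where
              in-χe : ε G x w ≡ true → image (vmap χ) (ε K e) (inj₂ w) ≡ true
              in-χe xw = trans (sym (comm χ e (inj₂ w))) (trans (cong (λ y → εt G y (inj₂ w)) χe≡x) xw)
              hit : (∃ λ v → ε K e v ≡ true × vmap χ v ≡ inj₂ w) → image βV (λ _ → true) w ≡ true
              hit (v , ev , χv≡w) = image-intro (v , ev) refl
                (inj₂-injective (trans (sym (proj₁ (proj₂ (old (v , ev))))) χv≡w))
              reached : (∃ λ s → true ≡ true × βV s ≡ w) → ε G x w ≡ true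
              reached (s , _ , refl) = proj₂ (proj₂ (old s))

      -- An edge sent into η[G] lies in the image of φ (probe with the edge it spans).
      χ-oldᴱ : ∀ e {x} → emap χ e ≡ inj₁ x → InImageᴱ e
      χ-oldᴱ e χe≡x with old-edge-cone e χe≡x
      ... | β , commutes with proj₂ χ-pullback _ (spanned-by K e) β commutes
      ... | u , ((_ , uEφ) , _) , _ = emap u tt , uEφ tt

      agreeⱽ : ∀ k → vmap χ k ≡ classifyⱽ k
      agreeⱽ k = by-cases lem (vmap χ k) refl
        where
          by-cases : (d : Dec (InImageⱽ k)) (y : Ṽ G) → vmap χ k ≡ y → vmap χ k ≡ classifyⱽ′ k d
          by-cases (yes (h , refl)) _ _  = proj₁ (proj₁ χ-pullback) h
          by-cases (no _) (inj₁ tt) χk≡y = χk≡y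
          by-cases (no ∉image) (inj₂ g) χk≡g = ⊥-elim (∉image (χ-oldⱽ k χk≡g))

      -- A new edge (0,X) of G̃ in the image of χ must have X = χ[ε_K e]
      -- (extensionality for subsets) and χ agrees with ψ̂ on vertices.
      agreeᴱ : ∀ e → emap χ e ≡ classifyᴱ e
      agreeᴱ e = by-cases lem (emap χ e) refl
        where
          new-edge : ∀ X → emap χ e ≡ inj₂ X → X ≡ image classifyⱽ (ε K e)
          new-edge X χe≡X = lower-extensionality Level.zero ℓ ext λ w →
            trans (sym (cong (λ y → εt G y w) χe≡X))
                  (trans (comm χ e w) (image-cong agreeⱽ (λ _ → refl) w))
          by-cases : (d : Dec (InImageᴱ e)) (y : E (tilde G)) → emap χ e ≡ y →
                     emap χ e ≡ classifyᴱ′ e d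
          by-cases (yes (e' , refl)) _ _ = proj₂ (proj₁ χ-pullback) e'
          by-cases (no ∉image) (inj₁ x) χe≡x = ⊥-elim (∉image (χ-oldᴱ e χe≡x))
          by-cases (no _) (inj₂ X) χe≡X = trans χe≡X (cong inj₂ (new-edge X χe≡X))

      unique : χ ≈ ψ̂
      unique = agreeⱽ , agreeᴱ

mainTheorem2 : {ℓ : Level} (lem : ExcludedMiddle ℓ) → Extensionality ℓ ℓ →
    let open Hyp lem in
    ((H K G : Hypergraph) (φ : Hom H K) (ψ : Hom H G) → IsMono φ →
      Σ (Hom K (tilde G)) λ ψ̂ → IsPullback φ ψ ψ̂ (η G) ×
        ((χ : Hom K (tilde G)) → IsPullback φ ψ χ (η G) → χ ≈ ψ̂))
    ×
    ((T : Hypergraph) (term : IsTerminal T) →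
      IsSubobjectClassifier T term (tilde T) (η T))
mainTheorem2 lem ext = classifies , λ T term H K φ mono → classifies H K T φ (proj₁ (term H)) mono
  where
    open Hyp lem
    classifies : (H K G : Hypergraph) (φ : Hom H K) (ψ : Hom H G) → IsMono φ →
      Σ (Hom K (tilde G)) λ ψ̂ → IsPullback φ ψ ψ̂ (η G) ×
        ((χ : Hom K (tilde G)) → IsPullback φ ψ χ (η G) → χ ≈ ψ̂)
    classifies H K G φ ψ mono = ψ̂ , pullback , unique
      where open Toolkit.Classifier lem ext H K G φ ψ mono
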